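{- Let $G$ be a finite group of odd order. (a) Every normal subgroup of $G$ is a perfect code of $G$. (b) No subgroup of $G$ is a total perfect code of $G$.
   Context: All groups and graphs are finite; $e$ denotes the identity of $G$. For $S\subseteq G$ with $e\notin S$ and $S^{ -1}=S$, the Cayley graph $\mathrm{Cay}(G,S)$ has vertex set $G$, with $x,y$ adjacent iff $yx^{ -1}\in S$. A subset $C$ of the vertex set of a graph is a perfect code if every vertex is at distance at most one from exactly one vertex of $C$; it is a total perfect code if every vertex has exactly one neighbour in $C$. A subset $C\subseteq G$ is called a perfect code (resp. total perfect code) of $G$ if it is a perfect code (resp. total perfect code) in some Cayley graph $\mathrm{Cay}(G,S)$ of $G$. -}

module Defs where

open import Data.Nat using (ℕ)
open import Data.Fin using (Fin)
open import Data.Fin.Subset using (Subset; _∈_; _∉_)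
open import Data.Product using (Σ; ∃; _×_; _,_)
open import Data.Sum using (_⊎_)
open import Relation.Binary.PropositionalEquality using (_≡_)
open import Algebra.Structures using (IsGroup)
open import Level using (0ℓ)

-- A finite group of order n: a group structure (in the sense of the
-- standard library's IsGroup, with propositional equality) on Fin n.
-- Every finite group of order n is isomorphic to one of these.
record FinGroup (n : ℕ) : Set where
  field
    _∙_     : Fin n → Fin n → Fin n
    e       : Fin n
    _⁻¹     : Fin n → Fin n
    isGroup : IsGroup _≡_ _∙_ e _⁻¹
  infixl 7 _∙_
  infix 8 _⁻¹

module _ {n : ℕ} (G : FinGroup n) where
  open FinGroup G

  IsSubgroup : Subset n → Set
  IsSubgroup H = (e ∈ H)
               × (∀ x y → x ∈ H → y ∈ H → x ∙ y ∈ H)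
               × (∀ x → x ∈ H → x ⁻¹ ∈ H)

  IsNormalSubgroup : Subset n → Set
  IsNormalSubgroup H = IsSubgroup H × (∀ g h → h ∈ H → g ∙ h ∙ g ⁻¹ ∈ H)

  IsConnectionSet : Subset n → Set
  IsConnectionSet S = (e ∉ S) × (∀ x → x ∈ S → x ⁻¹ ∈ S)

  Adj : Subset n → Fin n → Fin n → Set
  Adj S x y = y ∙ x ⁻¹ ∈ S

  ExactlyOneIn : Subset n → (Fin n → Set) → Set
  ExactlyOneIn C P = Σ (Fin n) λ c → (c ∈ C × P c) × (∀ c′ → c′ ∈ C → P c′ → c′ ≡ c)

  IsPerfectCodeIn : Subset n → Subset n → Set
  IsPerfectCodeIn S C = ∀ x → ExactlyOneIn C (λ c → (x ≡ c) ⊎ Adj S x c)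

  IsTotalPerfectCodeIn : Subset n → Subset n → Set
  IsTotalPerfectCodeIn S C = ∀ x → ExactlyOneIn C (λ c → Adj S x c)

  IsPerfectCodeOf : Subset n → Set
  IsPerfectCodeOf C = Σ (Subset n) λ S → IsConnectionSet S × IsPerfectCodeIn S C

  IsTotalPerfectCodeOf : Subset n → Set
  IsTotalPerfectCodeOf C = Σ (Subset n) λ S → IsConnectionSet S × IsTotalPerfectCodeIn S C

-- Both parts rest on two consequences of odd order: G has no element of
-- order 2, and for H normal, Hs = Hs⁻¹ forces s ∈ H.  Both are parity
-- arguments: an involution of a finite set fixes as many points as the set
-- has, modulo 2.
--
-- (b) If a subgroup H were a total perfect code, the unique neighbour c ∈ H
-- of e would lie in S, hence so would c⁻¹ ∈ H, so c = c⁻¹ and c = e ∉ S.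
--
-- (a) H is a perfect code in Cay(G,S) as soon as S meets every nontrivial
-- right coset of H in exactly one element.  The nontrivial cosets fall into
-- pairs {Hs, Hs⁻¹} of distinct cosets; taking from each pair the coset that
-- contains the least element of Hs ∪ Hs⁻¹, and that element or its inverse
-- respectively, gives such an S closed under inversion.

module Submission where

open import Defs
open import Data.Nat using (ℕ)
open import Data.Nat.Divisibility using (_∣_)
open import Data.Fin.Subset using (Subset)
open import Data.Product using (_×_)
open import Relation.Nullary using (¬_)

open import Algebra.Bundles using (Group)
open import Algebra.Structures using (IsGroup)
open import Data.Bool.Base using (true; false; if_then_else_)
open import Data.Empty using (⊥-elim)
open import Data.Fin.Base using (Fin; zero; suc; punchIn; _≤_; _<_)
open import Data.Fin.Permutation using (Permutation′; permutation; _⟨$⟩ʳ_)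
open import Data.Fin.Properties
  using (_≟_; _<?_; _≤?_; all?; ≤-antisym; <⇒≢; <-asym; ≤∧≢⇒<; punchInᵢ≢i)
open import Data.Fin.Subset using (_∈_; _∉_)
open import Data.Fin.Subset.Properties using (_∈?_)
open import Data.Nat.Base as ℕ using (_+_; _*_; z≤n; s≤s)
open import Data.Nat.Divisibility using (m∣m*n; ∣m+n∣m⇒∣n; ∣1⇒≡1)
open import Data.Nat.Properties
  using (+-0-commutativeMonoid; +-comm; +-identityʳ; ≮⇒≥)
open import Data.Product using (∃; _,_; proj₁; proj₂)
open import Data.Sum using (_⊎_; inj₁; inj₂)
open import Data.Unit using (tt)
open import Data.Vec.Base using (tabulate; lookup)
open import Data.Vec.Properties using ([]=⇒lookup; lookup⇒[]=; lookup∘tabulate)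
open import Function.Base using (_∘_)
open import Function.Bundles using (mk⇔)
open import Level using (Level; 0ℓ)
open import Relation.Binary.PropositionalEquality
open import Relation.Nullary using (Dec; yes; no; does)
open import Relation.Nullary.Decidable
  using (dec-true; dec-false; does-⇔; decidable-stable; _×-dec_; _⊎-dec_; ¬?; _→-dec_)
open import Relation.Unary using (Pred; Decidable; _⊆_; Empty; Universal)
open import Relation.Unary.Properties using (_∩?_; ∁?; U?)
open import Algebra.Properties.CommutativeMonoid.Sum +-0-commutativeMonoid
  using (sum; sum-cong-≗; ∑-distrib-+; sum-remove; sum-permute)
open import Algebra.Properties.Monoid.Sum
  (Algebra.Bundles.CommutativeMonoid.monoid +-0-commutativeMonoid)
  using (sum-replicate-zero)

private
  variable
    ℓ ℓ′ : Level
    n : ℕ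

indicator : {A : Set ℓ} → Dec A → ℕ
indicator a? = if does a? then 1 else 0

module _ {A : Set ℓ} (a? : Dec A) where

  indicator-yes : A → indicator a? ≡ 1
  indicator-yes a = cong (λ b → if b then 1 else 0) (dec-true a? a)

  indicator-no : ¬ A → indicator a? ≡ 0
  indicator-no ¬a = cong (λ b → if b then 1 else 0) (dec-false a? ¬a)

count : {P : Pred (Fin n) ℓ} → Decidable P → ℕ
count P? = sum (indicator ∘ P?)

count-cong : {P : Pred (Fin n) ℓ} {Q : Pred (Fin n) ℓ′} (P? : Decidable P) (Q? : Decidable Q) →
             P ⊆ Q → Q ⊆ P → count P? ≡ count Q?
count-cong P? Q? P⊆Q Q⊆P =
  sum-cong-≗ λ i → cong (λ b → if b then 1 else 0) (does-⇔ (mk⇔ P⊆Q Q⊆P) (P? i) (Q? i))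

count-split : {P : Pred (Fin n) ℓ} {Q : Pred (Fin n) ℓ′} (P? : Decidable P) (Q? : Decidable Q) →
              count P? ≡ count (P? ∩? Q?) + count (P? ∩? ∁? Q?)
count-split P? Q? =
  trans (sum-cong-≗ pointwise) (∑-distrib-+ (indicator ∘ (P? ∩? Q?)) (indicator ∘ (P? ∩? ∁? Q?)))
  where
  pointwise : ∀ i → indicator (P? i)
                  ≡ indicator (P? i ×-dec Q? i) + indicator (P? i ×-dec ¬? (Q? i))
  pointwise i with P? i | Q? i
  ... | yes _ | yes _ = refl
  ... | yes _ | no  _ = refl
  ... | no  _ | yes _ = refl
  ... | no  _ | no  _ = refl

count-empty : {P : Pred (Fin n) ℓ} (P? : Decidable P) → Empty P → count P? ≡ 0
count-empty {n} P? ∅P =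
  trans (sum-cong-≗ λ i → indicator-no (P? i) (∅P i)) (sum-replicate-zero n)

count-universal : {P : Pred (Fin n) ℓ} (P? : Decidable P) → Universal P → count P? ≡ n
count-universal {ℕ.zero}  P? ∀P = refl
count-universal {ℕ.suc n} P? ∀P =
  cong₂ _+_ (indicator-yes (P? zero) (∀P zero)) (count-universal (P? ∘ suc) (∀P ∘ suc))

count-unique : {P : Pred (Fin n) ℓ} (P? : Decidable P) →
               ∀ a → P a → (∀ {i} → P i → i ≡ a) → count P? ≡ 1
count-unique {ℕ.suc n} P? a Pa unique = begin
  count P?                                  ≡⟨ sum-remove {i = a} (indicator ∘ P?) ⟩
  indicator (P? a) + count (P? ∘ punchIn a) ≡⟨ cong₂ _+_ (indicator-yes (P? a) Pa) punchIn-empty ⟩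
  1 + 0                                     ∎
  where
  open ≡-Reasoning
  punchIn-empty : count (P? ∘ punchIn a) ≡ 0
  punchIn-empty = count-empty (P? ∘ punchIn a) λ j → punchInᵢ≢i a j ∘ unique

count-permute : {P : Pred (Fin n) ℓ} (P? : Decidable P) (π : Permutation′ n) →
                count P? ≡ count (P? ∘ (π ⟨$⟩ʳ_))
count-permute P? π = sum-permute (indicator ∘ P?) π

module _ {P : Pred (Fin n) ℓ} (P? : Decidable P) (f : Fin n → Fin n)
         (f-involutive : ∀ x → f (f x) ≡ x) (f-preserves-P : ∀ {x} → P x → P (f x)) where

  private
    Fixed? : Decidable (λ x → f x ≡ x)
    Fixed? x = f x ≟ x

    Below? : Decidable (λ x → x < f x)
    Below? x = x <? f x

    Above? : Decidable (λ x → f x < x)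
    Above? x = f x <? x

  -- The points of P moved by f come in pairs {x, f x}, one of each pair below the other.
  count-involution : count P? ≡ count (P? ∩? Fixed?) + 2 * count (P? ∩? Below?)
  count-involution = begin
    count P?
      ≡⟨ count-split P? Fixed? ⟩
    count (P? ∩? Fixed?) + count (P? ∩? ∁? Fixed?)
      ≡⟨ cong (count (P? ∩? Fixed?) +_) (count-split (P? ∩? ∁? Fixed?) Below?) ⟩
    count (P? ∩? Fixed?) + (count ((P? ∩? ∁? Fixed?) ∩? Below?) + count ((P? ∩? ∁? Fixed?) ∩? ∁? Below?))
      ≡⟨ cong₂ (λ a b → count (P? ∩? Fixed?) + (a + b)) moved-below moved-above ⟩
    count (P? ∩? Fixed?) + (count (P? ∩? Below?) + count (P? ∩? Below?))
      ≡⟨ cong (λ b → count (P? ∩? Fixed?) + (count (P? ∩? Below?) + b)) (sym (+-identityʳ _)) ⟩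
    count (P? ∩? Fixed?) + 2 * count (P? ∩? Below?)
      ∎
    where
    open ≡-Reasoning

    moved-below : count ((P? ∩? ∁? Fixed?) ∩? Below?) ≡ count (P? ∩? Below?)
    moved-below = count-cong ((P? ∩? ∁? Fixed?) ∩? Below?) (P? ∩? Below?)
      (λ ((Px , _) , x<fx) → Px , x<fx)
      (λ (Px , x<fx) → (Px , <⇒≢ x<fx ∘ sym) , x<fx)

    moved-above : count ((P? ∩? ∁? Fixed?) ∩? ∁? Below?) ≡ count (P? ∩? Below?)
    moved-above = begin
      count ((P? ∩? ∁? Fixed?) ∩? ∁? Below?)
        ≡⟨ count-cong ((P? ∩? ∁? Fixed?) ∩? ∁? Below?) (P? ∩? Above?)
             (λ ((Px , fx≢x) , x≮fx) → Px , ≤∧≢⇒< (≮⇒≥ x≮fx) fx≢x)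
             (λ (Px , fx<x) → (Px , <⇒≢ fx<x) , <-asym fx<x) ⟩
      count (P? ∩? Above?)
        ≡⟨ count-permute (P? ∩? Above?) (permutation f f f-involutive f-involutive) ⟩
      count ((P? ∩? Above?) ∘ f)
        ≡⟨ count-cong ((P? ∩? Above?) ∘ f) (P? ∩? Below?)
             (λ {x} (Pfx , ffx<fx) → subst P (f-involutive x) (f-preserves-P Pfx)
                                   , subst (_< f x) (f-involutive x) ffx<fx)
             (λ {x} (Px , x<fx) → f-preserves-P Px , subst (_< f x) (sym (f-involutive x)) x<fx) ⟩
      count (P? ∩? Below?)
        ∎

  even-count-of-fixedPointFree : (∀ {x} → P x → f x ≢ x) → 2 ∣ count P?
  even-count-of-fixedPointFree fixedPointFree =
    subst (2 ∣_) (sym count-involution)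
      (subst (λ c → 2 ∣ c + 2 * count (P? ∩? Below?))
             (sym (count-empty (P? ∩? Fixed?) λ x (Px , fx≡x) → fixedPointFree Px fx≡x))
             (m∣m*n (count (P? ∩? Below?))))

  odd-count-of-uniqueFixedPoint : ∀ a → P a → f a ≡ a → (∀ {x} → P x → f x ≡ x → x ≡ a) →
                                  ¬ 2 ∣ count P?
  odd-count-of-uniqueFixedPoint a Pa fa≡a unique 2∣count = 2≢1 (∣1⇒≡1 2∣1)
    where
    k = count (P? ∩? Below?)

    count≡2k+1 : count P? ≡ 2 * k + 1
    count≡2k+1 = trans count-involution
      (trans (cong (_+ 2 * k) (count-unique (P? ∩? Fixed?) a (Pa , fa≡a) λ (Px , fx≡x) → unique Px fx≡x))
             (+-comm 1 (2 * k)))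

    2∣1 : 2 ∣ 1
    2∣1 = ∣m+n∣m⇒∣n (subst (2 ∣_) count≡2k+1 2∣count) (m∣m*n k)

    2≢1 : 2 ≢ 1
    2≢1 ()

∃-least : {P : Pred (Fin n) ℓ} → Decidable P → ∀ {a} → P a →
          ∃ λ m → P m × (∀ {y} → P y → m ≤ y)
∃-least {ℕ.suc n} P? Pa with P? zero
... | yes P0 = zero , P0 , λ _ → z≤n
∃-least {ℕ.suc n} P? {zero}  Pa | no ¬P0 = ⊥-elim (¬P0 Pa)
∃-least {ℕ.suc n} P? {suc a} Pa | no ¬P0 with ∃-least (P? ∘ suc) Pa
... | m , Pm , least = suc m , Pm , λ { {zero} P0 → ⊥-elim (¬P0 P0) ; {suc y} Py → s≤s (least Py) }

fromDec : {P : Pred (Fin n) ℓ} → Decidable P → Subset n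
fromDec P? = tabulate (does ∘ P?)

module _ {P : Pred (Fin n) ℓ} (P? : Decidable P) {i : Fin n} where

  ∈-fromDec⁺ : P i → i ∈ fromDec P?
  ∈-fromDec⁺ Pi = lookup⇒[]= i (fromDec P?) (trans (lookup∘tabulate (does ∘ P?) i) (dec-true (P? i) Pi))

  ∈-fromDec⁻ : i ∈ fromDec P? → P i
  ∈-fromDec⁻ i∈ = decidable-stable (P? i) λ ¬Pi → false≢true (begin
    false               ≡⟨ dec-false (P? i) ¬Pi ⟨
    does (P? i)         ≡⟨ lookup∘tabulate (does ∘ P?) i ⟨
    lookup (fromDec P?) i ≡⟨ []=⇒lookup i∈ ⟩
    true                ∎)
    where
    open ≡-Reasoning
    false≢true : false ≢ true
    false≢true ()

module _ {n : ℕ} (G : FinGroup n) where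
  open FinGroup G
  open IsGroup isGroup using (assoc; identityʳ; inverseʳ)

  private
    group : Group 0ℓ 0ℓ
    group = record { isGroup = isGroup }

  open import Algebra.Properties.Group group
    using ( ∙-cancelˡ; ε⁻¹≈ε; ⁻¹-involutive; ⁻¹-injective; ⁻¹-anti-homo-//
          ; //-rightDividesˡ; //-rightDividesʳ)

  x∙e⁻¹≡x : ∀ x → x ∙ e ⁻¹ ≡ x
  x∙e⁻¹≡x x = trans (cong (x ∙_) ε⁻¹≈ε) (identityʳ x)

  -- Right multiplication by an involution c ≠ e pairs off the elements of G.
  x⁻¹≡x⇒x≡e : ¬ 2 ∣ n → ∀ {c} → c ⁻¹ ≡ c → c ≡ e
  x⁻¹≡x⇒x≡e n-odd {c} c⁻¹≡c = decidable-stable (c ≟ e) λ c≢e →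
    n-odd (subst (2 ∣_) (count-universal U? λ _ → tt)
      (even-count-of-fixedPointFree U? (_∙ c) ∙c-involutive (λ _ → tt)
        λ {x} _ xc≡x → c≢e (∙-cancelˡ x c e (trans xc≡x (sym (identityʳ x))))))
    where
    ∙c-involutive : ∀ x → x ∙ c ∙ c ≡ x
    ∙c-involutive x = trans (cong (x ∙ c ∙_) (sym c⁻¹≡c)) (//-rightDividesʳ c x)

  subgroup⇏totalPerfectCode : ¬ 2 ∣ n → (H : Subset n) → IsSubgroup G H → ¬ IsTotalPerfectCodeOf G H
  subgroup⇏totalPerfectCode n-odd H (_ , _ , H⁻¹⊆H) (S , (e∉S , S⁻¹⊆S) , total) with total e
  ... | c , (c∈H , ce⁻¹∈S) , unique = e∉S (subst (_∈ S) (x⁻¹≡x⇒x≡e n-odd c⁻¹≡c) c∈S)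
    where
    c∈S : c ∈ S
    c∈S = subst (_∈ S) (x∙e⁻¹≡x c) ce⁻¹∈S

    c⁻¹≡c : c ⁻¹ ≡ c
    c⁻¹≡c = unique (c ⁻¹) (H⁻¹⊆H c c∈H) (subst (_∈ S) (sym (x∙e⁻¹≡x (c ⁻¹))) (S⁻¹⊆S c c∈S))

  module Cosets {H : Subset n} (H≤G : IsSubgroup G H) where

    e∈H : e ∈ H
    e∈H = proj₁ H≤G

    ∙-closed : ∀ {x y} → x ∈ H → y ∈ H → x ∙ y ∈ H
    ∙-closed = proj₁ (proj₂ H≤G) _ _

    ⁻¹-closed : ∀ {x} → x ∈ H → x ⁻¹ ∈ H
    ⁻¹-closed = proj₂ (proj₂ H≤G) _

    ∉H⇒⁻¹∉H : ∀ {x} → x ∉ H → x ⁻¹ ∉ H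
    ∉H⇒⁻¹∉H {x} x∉H = x∉H ∘ subst (_∈ H) (⁻¹-involutive x) ∘ ⁻¹-closed

    infix 4 _~_ _~?_

    -- y ~ s  iff  Hy = Hs
    _~_ : Fin n → Fin n → Set
    y ~ s = y ∙ s ⁻¹ ∈ H

    _~?_ : ∀ y s → Dec (y ~ s)
    y ~? s = y ∙ s ⁻¹ ∈? H

    ~-refl : ∀ s → s ~ s
    ~-refl s = subst (_∈ H) (sym (inverseʳ s)) e∈H

    ~-sym : ∀ {y s} → y ~ s → s ~ y
    ~-sym {y} {s} y~s = subst (_∈ H) (⁻¹-anti-homo-// y s) (⁻¹-closed y~s)

    ~-trans : ∀ {x y z} → x ~ y → y ~ z → x ~ z
    ~-trans {x} {y} {z} x~y y~z =
      subst (_∈ H) (trans (sym (assoc _ _ _)) (cong (_∙ z ⁻¹) (//-rightDividesˡ y x))) (∙-closed x~y y~z)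

    ∈-resp-~ : ∀ {y s} → y ~ s → s ∈ H → y ∈ H
    ∈-resp-~ {y} {s} y~s s∈H = subst (_∈ H) (//-rightDividesˡ s y) (∙-closed y~s s∈H)

    coset-size : ∀ s → count (_~? s) ≡ count (_∈? H)
    coset-size s = begin
      count (_~? s)               ≡⟨ count-permute (_~? s) right-translation ⟩
      count (λ y → (y ∙ s) ~? s)  ≡⟨ count-cong (λ y → (y ∙ s) ~? s) (_∈? H)
                                       (λ {y} → subst (_∈ H) (//-rightDividesʳ s y))
                                       (λ {y} → subst (_∈ H) (sym (//-rightDividesʳ s y))) ⟩
      count (_∈? H)               ∎
      where
      open ≡-Reasoning
      right-translation : Permutation′ n
      right-translation = permutation (_∙ s) (_∙ s ⁻¹) (//-rightDividesˡ s) (//-rightDividesʳ s)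

    -- c ↦ c x⁻¹ matches the neighbours of x in H with the elements of S in the coset Hx⁻¹.
    transversal⇒perfectCode : {S : Subset n} → (∀ {s} → s ∈ S → s ∉ H) →
                              (∀ y → y ∉ H → ExactlyOneIn G S (_~ y)) → IsPerfectCodeIn G S H
    transversal⇒perfectCode {S} S∩H≡∅ meets x with x ∈? H
    ... | yes x∈H = x , (x∈H , inj₁ refl) , unique
      where
      unique : ∀ c → c ∈ H → x ≡ c ⊎ c ∙ x ⁻¹ ∈ S → c ≡ x
      unique c _   (inj₁ x≡c)    = sym x≡c
      unique c c∈H (inj₂ cx⁻¹∈S) = ⊥-elim (S∩H≡∅ cx⁻¹∈S (∙-closed c∈H (⁻¹-closed x∈H)))
    ... | no x∉H with meets (x ⁻¹) (∉H⇒⁻¹∉H x∉H)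
    ...   | s , (s∈S , s~x⁻¹) , s-unique =
            s ∙ x , (s∙x∈H , inj₂ (subst (_∈ S) (sym (//-rightDividesʳ x s)) s∈S)) , unique
      where
      s∙x∈H : s ∙ x ∈ H
      s∙x∈H = subst (λ z → s ∙ z ∈ H) (⁻¹-involutive x) s~x⁻¹

      unique : ∀ c → c ∈ H → x ≡ c ⊎ c ∙ x ⁻¹ ∈ S → c ≡ s ∙ x
      unique c c∈H (inj₁ x≡c)    = ⊥-elim (x∉H (subst (_∈ H) (sym x≡c) c∈H))
      unique c c∈H (inj₂ cx⁻¹∈S) = begin
        c               ≡⟨ //-rightDividesˡ x c ⟨
        c ∙ x ⁻¹ ∙ x    ≡⟨ cong (_∙ x) (s-unique (c ∙ x ⁻¹) cx⁻¹∈S cx⁻¹~x⁻¹) ⟩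
        s ∙ x           ∎
        where
        open ≡-Reasoning
        cx⁻¹~x⁻¹ : c ∙ x ⁻¹ ~ x ⁻¹
        cx⁻¹~x⁻¹ = subst (_∈ H) (sym (//-rightDividesʳ (x ⁻¹) c)) c∈H

  module NormalCosets {H : Subset n} (H⊴G : IsNormalSubgroup G H) where
    open Cosets (proj₁ H⊴G)

    ~-⁻¹ : ∀ {y s} → y ~ s → y ⁻¹ ~ s ⁻¹
    ~-⁻¹ {y} {s} y~s = subst (_∈ H) conjugate≡ (proj₂ H⊴G (y ⁻¹) (s ∙ y ⁻¹) (~-sym y~s))
      where
      conjugate≡ : y ⁻¹ ∙ (s ∙ y ⁻¹) ∙ y ⁻¹ ⁻¹ ≡ y ⁻¹ ∙ s ⁻¹ ⁻¹
      conjugate≡ = begin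
        y ⁻¹ ∙ (s ∙ y ⁻¹) ∙ y ⁻¹ ⁻¹ ≡⟨ cong (_∙ y ⁻¹ ⁻¹) (assoc (y ⁻¹) s (y ⁻¹)) ⟨
        y ⁻¹ ∙ s ∙ y ⁻¹ ∙ y ⁻¹ ⁻¹   ≡⟨ //-rightDividesʳ (y ⁻¹) (y ⁻¹ ∙ s) ⟩
        y ⁻¹ ∙ s                    ≡⟨ cong (y ⁻¹ ∙_) (⁻¹-involutive s) ⟨
        y ⁻¹ ∙ s ⁻¹ ⁻¹              ∎
        where open ≡-Reasoning

    ~⁻¹-⁻¹ : ∀ {y s} → y ~ s ⁻¹ → y ⁻¹ ~ s
    ~⁻¹-⁻¹ {y} {s} y~s⁻¹ = subst (y ⁻¹ ~_) (⁻¹-involutive s) (~-⁻¹ y~s⁻¹)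

    infix 4 _≃_ _≃?_
    _≃_ : Fin n → Fin n → Set
    y ≃ s = y ~ s ⊎ y ~ s ⁻¹

    _≃?_ : ∀ y s → Dec (y ≃ s)
    y ≃? s = y ~? s ⊎-dec y ~? s ⁻¹

    ≃-refl : ∀ s → s ≃ s
    ≃-refl s = inj₁ (~-refl s)

    ≃-sym : ∀ {y s} → y ≃ s → s ≃ y
    ≃-sym (inj₁ y~s)   = inj₁ (~-sym y~s)
    ≃-sym (inj₂ y~s⁻¹) = inj₂ (~-sym (~⁻¹-⁻¹ y~s⁻¹))

    ≃-trans : ∀ {x y z} → x ≃ y → y ≃ z → x ≃ z
    ≃-trans (inj₁ x~y)   (inj₁ y~z)   = inj₁ (~-trans x~y y~z)
    ≃-trans (inj₁ x~y)   (inj₂ y~z⁻¹) = inj₂ (~-trans x~y y~z⁻¹)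
    ≃-trans (inj₂ x~y⁻¹) (inj₁ y~z)   = inj₂ (~-trans x~y⁻¹ (~-⁻¹ y~z))
    ≃-trans (inj₂ x~y⁻¹) (inj₂ y~z⁻¹) = inj₁ (~-trans x~y⁻¹ (~⁻¹-⁻¹ y~z⁻¹))

    ≃-⁻¹ʳ : ∀ {y s} → y ≃ s → y ≃ s ⁻¹
    ≃-⁻¹ʳ {y} {s} (inj₁ y~s)   = inj₂ (subst (y ~_) (sym (⁻¹-involutive s)) y~s)
    ≃-⁻¹ʳ         (inj₂ y~s⁻¹) = inj₁ y~s⁻¹

    ≃-⁻¹ˡ : ∀ {y s} → y ≃ s → y ⁻¹ ≃ s
    ≃-⁻¹ˡ = ≃-sym ∘ ≃-⁻¹ʳ ∘ ≃-sym

    IsLeast : Fin n → Set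
    IsLeast s = ∀ y → y ≃ s → s ≤ y

    IsLeast? : ∀ s → Dec (IsLeast s)
    IsLeast? s = all? λ y → y ≃? s →-dec s ≤? y

    IsLeast-unique : ∀ {a b} → IsLeast a → IsLeast b → a ≃ b → a ≡ b
    IsLeast-unique {a} {b} a-least b-least a≃b = ≤-antisym (a-least b (≃-sym a≃b)) (b-least a a≃b)

    InTransversal : Fin n → Set
    InTransversal s = s ∉ H × (IsLeast s ⊎ IsLeast (s ⁻¹))

    InTransversal? : Decidable InTransversal
    InTransversal? s = ¬? (s ∈? H) ×-dec (IsLeast? s ⊎-dec IsLeast? (s ⁻¹))

    transversal : Subset n
    transversal = fromDec InTransversal?

    InTransversal-⁻¹ : ∀ {s} → InTransversal s → InTransversal (s ⁻¹)
    InTransversal-⁻¹ {s} (s∉H , inj₁ s-least)   =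
      ∉H⇒⁻¹∉H s∉H , inj₂ (subst IsLeast (sym (⁻¹-involutive s)) s-least)
    InTransversal-⁻¹     (s∉H , inj₂ s⁻¹-least) =
      ∉H⇒⁻¹∉H s∉H , inj₁ s⁻¹-least

    transversal-connectionSet : IsConnectionSet G transversal
    transversal-connectionSet =
        (λ e∈T → proj₁ (∈-fromDec⁻ InTransversal? e∈T) e∈H)
      , (λ s s∈T → ∈-fromDec⁺ InTransversal? (InTransversal-⁻¹ (∈-fromDec⁻ InTransversal? s∈T)))

    transversal-meets : ∀ {y} → y ∉ H → ∃ λ s → InTransversal s × s ~ y
    transversal-meets {y} y∉H with ∃-least (_≃? y) (≃-refl y)
    ... | m , m≃y , m-minimal = representative m≃y
      where
      m-least : IsLeast m
      m-least z z≃m = m-minimal (≃-trans z≃m m≃y)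

      in-transversal : ∀ {s} → s ~ y → IsLeast s ⊎ IsLeast (s ⁻¹) → ∃ λ s → InTransversal s × s ~ y
      in-transversal {s} s~y least = s , (y∉H ∘ ∈-resp-~ (~-sym s~y) , least) , s~y

      representative : m ≃ y → ∃ λ s → InTransversal s × s ~ y
      representative (inj₁ m~y)   = in-transversal m~y (inj₁ m-least)
      representative (inj₂ m~y⁻¹) =
        in-transversal (~⁻¹-⁻¹ m~y⁻¹) (inj₂ (subst IsLeast (sym (⁻¹-involutive m)) m-least))

    module _ (n-odd : ¬ 2 ∣ n) where

      -- Inversion pairs off the elements of Hs, but fixes only e in H, while |Hs| = |H|.
      ~⁻¹⇒∈H : ∀ {s} → s ~ s ⁻¹ → s ∈ H
      ~⁻¹⇒∈H {s} s~s⁻¹ = decidable-stable (s ∈? H) λ s∉H →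
        odd-count-of-uniqueFixedPoint (_∈? H) _⁻¹ ⁻¹-involutive ⁻¹-closed e e∈H ε⁻¹≈ε
          (λ _ → x⁻¹≡x⇒x≡e n-odd)
          (subst (2 ∣_) (coset-size s)
            (even-count-of-fixedPointFree (_~? s) _⁻¹ ⁻¹-involutive
              (λ y~s → ~-trans (~-⁻¹ y~s) (~-sym s~s⁻¹))
              λ y~s y⁻¹≡y → s∉H (∈-resp-~ (~-sym y~s) (subst (_∈ H) (sym (x⁻¹≡x⇒x≡e n-odd y⁻¹≡y)) e∈H))))

      transversal-unique : ∀ {s t} → InTransversal s → InTransversal t → s ~ t → s ≡ t
      transversal-unique {s} {t} (s∉H , s-least) (_ , t-least) s~t = from-least s-least t-least
        where
        t≢s⁻¹ : t ≢ s ⁻¹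
        t≢s⁻¹ t≡s⁻¹ = s∉H (~⁻¹⇒∈H (subst (s ~_) t≡s⁻¹ s~t))

        from-least : IsLeast s ⊎ IsLeast (s ⁻¹) → IsLeast t ⊎ IsLeast (t ⁻¹) → s ≡ t
        from-least (inj₁ s-least)   (inj₁ t-least)   = IsLeast-unique s-least t-least (inj₁ s~t)
        from-least (inj₁ s-least)   (inj₂ t⁻¹-least) = ⊥-elim (t≢s⁻¹ (begin
          t       ≡⟨ ⁻¹-involutive t ⟨
          t ⁻¹ ⁻¹ ≡⟨ cong _⁻¹ (IsLeast-unique s-least t⁻¹-least (≃-⁻¹ʳ (inj₁ s~t))) ⟨
          s ⁻¹    ∎))
          where open ≡-Reasoning
        from-least (inj₂ s⁻¹-least) (inj₁ t-least)   =
          ⊥-elim (t≢s⁻¹ (sym (IsLeast-unique s⁻¹-least t-least (≃-⁻¹ˡ (inj₁ s~t)))))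
        from-least (inj₂ s⁻¹-least) (inj₂ t⁻¹-least) =
          ⁻¹-injective (IsLeast-unique s⁻¹-least t⁻¹-least (≃-⁻¹ˡ (≃-⁻¹ʳ (inj₁ s~t))))

      transversal-exactlyOne : ∀ y → y ∉ H → ExactlyOneIn G transversal (_~ y)
      transversal-exactlyOne y y∉H with transversal-meets y∉H
      ... | s , s∈T , s~y = s , (∈-fromDec⁺ InTransversal? s∈T , s~y) , λ t t∈T t~y →
        transversal-unique (∈-fromDec⁻ InTransversal? t∈T) s∈T (~-trans t~y (~-sym s~y))

  normalSubgroup⇒perfectCode : ¬ 2 ∣ n → (H : Subset n) → IsNormalSubgroup G H → IsPerfectCodeOf G H
  normalSubgroup⇒perfectCode n-odd H H⊴G =
      transversal
    , transversal-connectionSet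
    , transversal⇒perfectCode (proj₁ ∘ ∈-fromDec⁻ InTransversal?) (transversal-exactlyOne n-odd)
    where
    open Cosets (proj₁ H⊴G)
    open NormalCosets H⊴G

corollary2p4 : (n : ℕ) (G : FinGroup n) → ¬ (2 ∣ n) →
    ((H : Subset n) → IsNormalSubgroup G H → IsPerfectCodeOf G H)
    × ((H : Subset n) → IsSubgroup G H → ¬ IsTotalPerfectCodeOf G H)
corollary2p4 n G n-odd = normalSubgroup⇒perfectCode G n-odd , subgroup⇏totalPerfectCode G n-odd
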